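{- (a) Every ecumenical formula all of whose subformulas (including itself) carry the superscript $i$ is monotonic. (b) For every $p\in\mathsf{At}$, the formula $p^c$ is not monotonic.
   Context: Basic setting. Let $\mathsf{At}$ be a countably infinite set of atomic propositions and $\mathsf{At}_\bot=\mathsf{At}\cup\{\bot\}$. An atomic rule has the form "from premises $p_1,\dots,p_n$ ($n\ge 0$) infer $p$", with $p_j,p\in\mathsf{At}_\bot$, where the derivation of each premise may discharge a set of basic sentences. An atomic system $S$ is a set of atomic rules; $S\subseteq S'$ ($S'$ extends $S$) if $S'$ contains all rules of $S$. $\Delta\vdash_S p$ means there is a natural-deduction derivation using only rules of $S$ with conclusion $p$ and undischarged assumptions in $\Delta$ (so $p\vdash_S p$). $S$ is consistent if $\nvdash_S\bot$. Standing convention: all atomic systems (including all extensions quantified over) are required to be consistent. Ecumenical formulas: $p^i,p^c$ for $p\in\mathsf{At}_\bot$; $(A\wedge B)^x,(A\vee B)^x,(A\to B)^x$ for $x\in\{i,c\}$. $A\wedge B$, $A\vee B$, $A\to B$ abbreviate the $i$-versions, $\bot$ denotes $\bot^i$, $\neg A:=(A\to\bot^i)^i$; for $X^c$, $X^i$ is the same construction with outer superscript $i$. Weak validity (by simultaneous recursion): (1) $\Vdash^L_S p^i$ iff $\vdash_S p$ ($p\in\mathsf{At}_\bot$); (2) $\Vdash^L_S p^c$ iff $p\nvdash_S\bot$; (3) for non-atomic $X$, $\Vdash^L_S X^c$ iff $X^i\nVdash^L_S\bot$; (4) $\Vdash^L_S(A\wedge B)^i$ iff $\Vdash^L_S A$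 and $\Vdash^L_S B$; (5) $\Vdash^L_S(A\to B)^i$ iff $A\Vdash^G_S B$; (6) $\Vdash^L_S(A\vee B)^i$ iff for all $S'\supseteq S$ and all $p\in\mathsf{At}_\bot$, if $A\Vdash^L_{S'}p^i$ and $B\Vdash^L_{S'}p^i$ then $\Vdash^L_{S'}p^i$; (7) for nonempty $\Gamma$, $\Gamma\Vdash^L_S A$ iff for all $S'\supseteq S$, if $\Vdash^L_{S'}B$ for all $B\in\Gamma$ then $\Vdash^L_{S'}A$; (8) $\Gamma\Vdash^G_S A$ iff for all $S'\supseteq S$: if $\Vdash^L_{S''}B$ for all $B\in\Gamma$ and all $S''\supseteq S'$, then $\Vdash^L_{S''}A$ for all $S''\supseteq S'$. A formula $A$ is $S$-monotonic if for all $S'\supseteq S$, $\Vdash^L_S A$ implies $\Vdash^L_{S'}A$; $A$ is monotonic if it is $S$-monotonic for every atomic system $S$. -}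

module Defs where

open import Level using (Level; Lift; 0ℓ) renaming (suc to lsuc)
open import Data.Nat using (ℕ)
open import Data.List using (List; []; _∷_; _++_)
open import Data.List.Membership.Propositional using (_∈_)
open import Data.List.Relation.Unary.All using (All)
open import Data.Product using (_×_; _,_; proj₁; proj₂)
open import Relation.Nullary using (¬_)
open import Relation.Binary.PropositionalEquality using (_≡_)

data Atom : Set where
  atom : ℕ → Atom
  bot  : Atom

-- An atomic rule: premises p_j, each derived while possibly discharging a
-- (finite) set of basic sentences, and a conclusion p.
record Rule : Set where
  constructor mkRule
  field
    prems : List (List Atom × Atom)   -- (discharged sentences , premise)
    concl : Atom
open Rule public

Sys : Set₁
Sys = Rule → Set

_⊆S_ : Sys → Sys → Set
S ⊆S S' = ∀ r → S r → S' r

data Der (S : Sys) (Δ : List Atom) : Atom → Set where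
  ax   : ∀ {p} → p ∈ Δ → Der S Δ p
  rule : (r : Rule) → S r →
         All (λ pr → Der S (proj₁ pr ++ Δ) (proj₂ pr)) (prems r) →
         Der S Δ (concl r)

Consistent : Sys → Set
Consistent S = ¬ Der S [] bot

-- S' is a (consistent) extension of S (standing convention)
Ext : Sys → Sys → Set
Ext S S' = S ⊆S S' × Consistent S'

data Kind : Set where
  i c : Kind

data Form : Set where
  atm  : Kind → Atom → Form
  conj : Kind → Form → Form → Form
  disj : Kind → Form → Form → Form
  imp  : Kind → Form → Form → Form

L1 : Set → Set₁
L1 = Lift (lsuc 0ℓ)

mutual
  V : Sys → Form → Set₁
  V S (atm i p)    = L1 (Der S [] p)
  V S (atm c p)    = L1 (¬ Der S (p ∷ []) bot)
  V S (conj i A B) = VConj S A B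
  V S (disj i A B) = VDisj S A B
  V S (imp i A B)  = G S A B
  -- (3): X^c valid iff X^i ⊩^L_S ⊥ fails, with (7) unfolded
  V S (conj c A B) = ¬ (∀ S' → Ext S S' → VConj S' A B → L1 (Der S' [] bot))
  V S (disj c A B) = ¬ (∀ S' → Ext S S' → VDisj S' A B → L1 (Der S' [] bot))
  V S (imp c A B)  = ¬ (∀ S' → Ext S S' → G S' A B → L1 (Der S' [] bot))

  VConj : Sys → Form → Form → Set₁
  VConj S A B = V S A × V S B

  -- (6), with A ⊩^L_{S'} p^i unfolded via (7)
  VDisj : Sys → Form → Form → Set₁
  VDisj S A B = ∀ S' → Ext S S' → (p : Atom) →
    (∀ S'' → Ext S' S'' → V S'' A → L1 (Der S'' [] p)) →
    (∀ S'' → Ext S' S'' → V S'' B → L1 (Der S'' [] p)) →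
    L1 (Der S' [] p)

  -- (8) with a single premise: A ⊩^G_S B
  G : Sys → Form → Form → Set₁
  G S A B = ∀ S' → Ext S S' →
    (∀ S'' → Ext S' S'' → V S'' A) →
    (∀ S'' → Ext S' S'' → V S'' B)

SMonotonic : Sys → Form → Set₁
SMonotonic S A = ∀ S' → Ext S S' → V S A → V S' A

Monotonic : Form → Set₁
Monotonic A = ∀ S → Consistent S → SMonotonic S A

AllI : Form → Set
AllI (atm k p)    = k ≡ i
AllI (conj k A B) = k ≡ i × AllI A × AllI B
AllI (disj k A B) = k ≡ i × AllI A × AllI B
AllI (imp k A B)  = k ≡ i × AllI A × AllI B

-- Atomic derivability survives extending the system, and the clauses for ∨ and →
-- already quantify over all extensions, so the i-fragment is monotonic by induction
-- on formulas.  For p^c: in the empty system p is consistent, but adding the single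
-- rule "from p infer ⊥" yields a consistent extension in which p ⊢ ⊥.
module Submission where

open import Defs
open import Data.Nat using (ℕ)
open import Data.Product using (_×_; _,_; proj₁; proj₂)
open import Relation.Nullary using (¬_)
open import Level using (lift)
open import Data.Empty using (⊥)
open import Data.List using (List; []; _∷_; _++_)
open import Data.List.Relation.Unary.All using (All; []; _∷_)
open import Data.List.Relation.Unary.Any using (here; there)
open import Relation.Binary.PropositionalEquality using (_≡_; refl)

mutual
  Der-mono : ∀ {S S' Δ p} → S ⊆S S' → Der S Δ p → Der S' Δ p
  Der-mono S⊆S' (ax p∈Δ)        = ax p∈Δ
  Der-mono S⊆S' (rule r r∈S ds) = rule r (S⊆S' r r∈S) (Der-mono-All S⊆S' ds)

  Der-mono-All : ∀ {S S' Δ} {prs : List (List Atom × Atom)} → S ⊆S S' →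
                 All (λ pr → Der S  (proj₁ pr ++ Δ) (proj₂ pr)) prs →
                 All (λ pr → Der S' (proj₁ pr ++ Δ) (proj₂ pr)) prs
  Der-mono-All S⊆S' []       = []
  Der-mono-All S⊆S' (d ∷ ds) = Der-mono S⊆S' d ∷ Der-mono-All S⊆S' ds

Ext-trans : ∀ {S S' S''} → Ext S S' → Ext S' S'' → Ext S S''
Ext-trans (S⊆S' , _) (S'⊆S'' , S''-consistent) =
  (λ r r∈S → S'⊆S'' r (S⊆S' r r∈S)) , S''-consistent

allI⇒monotonic : (A : Form) → AllI A → Monotonic A
allI⇒monotonic (atm .i p) refl S _ S' S⊑S' (lift d) = lift (Der-mono (proj₁ S⊑S') d)
allI⇒monotonic (conj .i A B) (refl , allI-A , allI-B) S S-consistent S' S⊑S' (vA , vB) =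
  allI⇒monotonic A allI-A S S-consistent S' S⊑S' vA ,
  allI⇒monotonic B allI-B S S-consistent S' S⊑S' vB
allI⇒monotonic (disj .i A B) (refl , _) S _ S' S⊑S' v S'' S'⊑S'' = v S'' (Ext-trans S⊑S' S'⊑S'')
allI⇒monotonic (imp .i A B)  (refl , _) S _ S' S⊑S' v S'' S'⊑S'' = v S'' (Ext-trans S⊑S' S'⊑S'')

∅ : Sys
∅ _ = ⊥

∅-consistent : Consistent ∅
∅-consistent (ax ())

∅-atom-consistent : ∀ n → ¬ Der ∅ (atom n ∷ []) bot
∅-atom-consistent n (ax (here ()))
∅-atom-consistent n (ax (there ()))

refute : ℕ → Sys
refute n r = r ≡ mkRule (([] , atom n) ∷ []) bot

refute-derives-no-atom : ∀ n m → ¬ Der (refute n) [] (atom m)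
refute-derives-no-atom n m (ax ())
refute-derives-no-atom n m (rule _ () _)

refute-consistent : ∀ n → Consistent (refute n)
refute-consistent n (rule _ refl (d ∷ [])) = refute-derives-no-atom n n d

refute-refutes : ∀ n → Der (refute n) (atom n ∷ []) bot
refute-refutes n = rule _ refl (ax (here refl) ∷ [])

atomᶜ-not-monotonic : (n : ℕ) → ¬ Monotonic (atm c (atom n))
atomᶜ-not-monotonic n mono
  with mono ∅ ∅-consistent (refute n) ((λ _ ()) , refute-consistent n)
            (lift (∅-atom-consistent n))
... | lift atom-n-consistent = atom-n-consistent (refute-refutes n)

theorem4 : ((A : Form) → AllI A → Monotonic A)
         × ((n : ℕ) → ¬ Monotonic (atm c (atom n)))
theorem4 = allI⇒monotonic , atomᶜ-not-monotonic
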